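{- Let $G$ be a finite abelian $p$-group, $G=\mathbb{Z}_{p^{t_1}}\times\mathbb{Z}_{p^{t_2}}\times\cdots\times\mathbb{Z}_{p^{t_r}}$, where $r\ge 2$ and $1\le t_1\le t_2\le\cdots\le t_r$. Then the number of connected components of $\mathcal{G}^{**}_e(G)$ is $\frac{p^r-1}{p-1}$.
   Context: For a finite group $G$, the enhanced power graph $\mathcal{G}_e(G)$ is the simple graph with vertex set $G$ in which two distinct vertices $u,v$ are adjacent if and only if there exists $w\in G$ such that both $u$ and $v$ are powers of $w$. A dominating vertex is a vertex adjacent to every other vertex. $\mathcal{G}^{**}_e(G)$ is the induced subgraph of $\mathcal{G}_e(G)$ obtained by deleting all dominating vertices. -}

module Defs where

open import Data.Nat using (ℕ; zero; suc; _+_; _*_; _∸_; _^_; _≤_; _<_; NonZero; NonTrivial)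
open import Data.Nat.Primality using (Prime; prime⇒nonTrivial)
open import Data.Fin using (Fin)
open import Data.Vec using (Vec; lookup)
open import Data.Product using (Σ; ∃; ∃₂; _×_; _,_)
open import Relation.Nullary using (¬_)
open import Relation.Binary.PropositionalEquality using (_≡_; _≢_)
open import Relation.Binary.Construct.Closure.ReflexiveTransitive using (Star)
open import Function using (_⇔_; Surjective)

_≡_[mod_] : ℕ → ℕ → ℕ → Set
a ≡ b [mod m ] = ∃₂ λ x y → a + x * m ≡ b + y * m

-- The group G = ℤ_{p^{t_1}} × ... × ℤ_{p^{t_r}}, with t = (t_1,…,t_r).
-- Elements are represented by their canonical representatives:
-- vectors u with 0 ≤ u_i < p^{t_i}.
module _ (p : ℕ) {r : ℕ} (t : Vec ℕ r) where

  InG : Vec ℕ r → Set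
  InG u = ∀ (i : Fin r) → lookup u i < p ^ lookup t i

  -- u is a power of w (u = w^k, written additively u = k·w), for some k ≥ 0.
  -- (G is finite, so negative powers are also nonnegative powers.)
  IsPowerOf : Vec ℕ r → Vec ℕ r → Set
  IsPowerOf u w = ∃ λ (k : ℕ) →
    ∀ (i : Fin r) → lookup u i ≡ k * lookup w i [mod p ^ lookup t i ]

  Adj : Vec ℕ r → Vec ℕ r → Set
  Adj u v = u ≢ v × ∃ λ w → InG w × IsPowerOf u w × IsPowerOf v w

  Dominating : Vec ℕ r → Set
  Dominating u = ∀ v → InG v → v ≢ u → Adj u v

  Vertex** : Vec ℕ r → Set
  Vertex** u = InG u × ¬ Dominating u

  Edge** : Vec ℕ r → Vec ℕ r → Set
  Edge** u v = Vertex** u × Vertex** v × Adj u v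

  Connected** : Vec ℕ r → Vec ℕ r → Set
  Connected** = Star Edge**

  -- G**_e(G) has exactly N connected components: there is a surjective labelling
  -- of its vertices by Fin N whose fibres are exactly the connected components.
  NumComponents** : ℕ → Set
  NumComponents** N =
    Σ (Σ (Vec ℕ r) Vertex** → Fin N) λ f →
      Surjective _≡_ _≡_ f ×
      (∀ (x y : Σ (Vec ℕ r) Vertex**) →
         (f x ≡ f y) ⇔ Connected** (Σ.proj₁ x) (Σ.proj₁ y))

prime⇒pred-nonZero : ∀ {p} → Prime p → NonZero (p ∸ 1)
prime⇒pred-nonZero {p} pp = helper (prime⇒nonTrivial pp)
  where
  helper : ∀ {n} → NonTrivial n → NonZero (n ∸ 1)
  helper {suc (suc n)} _ = _

module Submission where

-- Let G = ℤ_{p^t₁} × ⋯ × ℤ_{p^tᵣ} with all tᵢ ≥ 1 and r ≥ 2.  Every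
-- nonzero u ∈ G has order p^(1+m) for a unique m, and p^m·u is a nonzero
-- element of the socle Ω = {x | p·x = 0} ≅ 𝔽_p^r.  The *label* of u is the
-- projective point of p^m·u, i.e. its coordinate vector up to a unit scalar.
--   * If u = k·w (k = p^a·k', p ∤ k') then w has order p^(1+m+a) and
--     p^m·u = k'·p^(m+a)·w, so u and w have the same label.  Hence labels
--     are constant along edges of the enhanced power graph.
--   * Since r ≥ 2 there are two labels, so no nonzero element dominates;
--     0 dominates, so the vertices of G**ₑ(G) are exactly the nonzero u.
--   * Two vertices with the same label P are joined by the path
--     u — p^m·u — e_P — p^m'·v — v, where e_P (pointElement P) is the
--     socle element with coordinates P.
-- So components correspond to points of the projective space P^{r-1}(𝔽_p),
-- of which there are (p^r − 1)/(p − 1).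

open import Defs
open import Data.Nat using (ℕ; _∸_; _^_; _≤_)
open import Data.Nat.DivMod using (_/_)
open import Data.Nat.Primality using (Prime)
open import Data.Fin using (Fin) renaming (_≤_ to _≤ᶠ_)
open import Data.Vec using (Vec; lookup)

open import Data.Nat using (zero; suc; _+_; _*_; _<_; s≤s; z≤n; NonZero; _≟_; nonTrivial⇒n>1; ≢-nonZero)
open import Data.Nat.Properties
open import Data.Nat.DivMod
open import Data.Nat.Divisibility
open import Data.Nat.Primality
open import Data.Nat.Coprimality using (Coprime; coprime-Bézout)
open import Data.Nat.GCD using (module Bézout)
open import Data.Nat.Solver using (module +-*-Solver)
open import Data.Fin using (toℕ)
open import Data.Fin.Properties using (toℕ-injective; toℕ-fromℕ<; toℕ<n; all?; *↔×; +↔⊎)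
open import Data.Vec using ([]; _∷_; map; tabulate; replicate; sum)
open import Data.Vec.Properties using (lookup-map; lookup∘tabulate; lookup-replicate; tabulate∘lookup; tabulate-cong; ≡-dec)
open import Data.Maybe using (Maybe; just; nothing)
import Data.Maybe as Maybe
open import Data.Maybe.Properties using (just-injective)
open import Data.Product using (Σ; ∃; _×_; _,_; proj₁; proj₂)
open import Data.Sum using (_⊎_; inj₁; inj₂)
open import Data.Product.Function.NonDependent.Propositional using (_×-↔_)
open import Data.Sum.Function.Propositional using (_⊎-↔_)
open import Data.Empty using (⊥-elim)
open import Relation.Nullary using (¬_; Dec; yes; no)
open import Relation.Binary.PropositionalEquality
open import Relation.Binary.Definitions using (tri<; tri≈; tri>)
open import Relation.Binary.Construct.Closure.ReflexiveTransitive using (ε; _◅_; _◅◅_)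
open import Function using (_∘_; _⇔_; mk⇔; _↔_; mk↔ₛ′; Inverse; Equivalence; Surjective)
open import Function.Properties.Inverse using (↔-refl; ↔-sym; ↔-trans)
open +-*-Solver

vecExt : ∀ {A : Set} {n} (u v : Vec A n) → (∀ i → lookup u i ≡ lookup v i) → u ≡ v
vecExt u v h = trans (sym (tabulate∘lookup u)) (trans (tabulate-cong h) (tabulate∘lookup v))

lookup≤sum : ∀ {n} (v : Vec ℕ n) i → lookup v i ≤ sum v
lookup≤sum (x ∷ v) Fin.zero = m≤m+n x (sum v)
lookup≤sum (x ∷ v) (Fin.suc i) = ≤-trans (lookup≤sum v i) (m≤n+m (sum v) x)

firstSwitch : (Q : ℕ → Set) → (∀ j → Dec (Q j)) → ¬ Q 0 → ∀ B → Q B → Σ ℕ λ j → ¬ Q j × Q (suc j)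
firstSwitch Q Q? ¬Q0 zero QB = ⊥-elim (¬Q0 QB)
firstSwitch Q Q? ¬Q0 (suc B) QB with Q? B
... | yes QB' = firstSwitch Q Q? ¬Q0 B QB'
... | no ¬QB' = B , ¬QB' , QB

[mod]⇒% : ∀ {a b} m .{{_ : NonZero m}} → a ≡ b [mod m ] → a % m ≡ b % m
[mod]⇒% {a} {b} m (x , y , e) =
  trans (sym ([m+kn]%n≡m%n a x m)) (trans (cong (_% m) e) ([m+kn]%n≡m%n b y m))

%⇒[mod] : ∀ {a b} m .{{_ : NonZero m}} → a % m ≡ b % m → a ≡ b [mod m ]
%⇒[mod] {a} {b} m e = b / m , a / m , (begin
    a + b / m * m                 ≡⟨ cong (_+ b / m * m) (m≡m%n+[m/n]*n a m) ⟩
    a % m + a / m * m + b / m * m ≡⟨ cong (λ z → z + a / m * m + b / m * m) e ⟩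
    b % m + a / m * m + b / m * m ≡⟨ swap (b % m) (a / m * m) (b / m * m) ⟩
    b % m + b / m * m + a / m * m ≡⟨ cong (_+ a / m * m) (sym (m≡m%n+[m/n]*n b m)) ⟩
    b + a / m * m                 ∎)
  where
  open ≡-Reasoning
  swap : ∀ x y z → x + y + z ≡ x + z + y
  swap = solve 3 (λ x y z → x :+ y :+ z := x :+ z :+ y) refl

%-*-congˡ : ∀ c {a b} m .{{_ : NonZero m}} → a % m ≡ b % m → (c * a) % m ≡ (c * b) % m
%-*-congˡ c {a} {b} m e = begin
    (c * a) % m             ≡⟨ %-distribˡ-* c a m ⟩
    ((c % m) * (a % m)) % m ≡⟨ cong (λ z → ((c % m) * z) % m) e ⟩
    ((c % m) * (b % m)) % m ≡⟨ sym (%-distribˡ-* c b m) ⟩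
    (c * b) % m             ∎
  where open ≡-Reasoning

%-∣ : ∀ {a b} m .{{_ : NonZero m}} → a % m ≡ b % m → m ∣ a → m ∣ b
%-∣ {a} {b} m e d = m%n≡0⇒n∣m b m (trans (sym e) (n∣m⇒m%n≡0 a m d))

%-scaled : ∀ p D .{{_ : NonZero p}} .{{_ : NonZero D}} .{{_ : NonZero (p * D)}} X → D ∣ X →
           D * ((X / D) % p) ≡ X % (p * D)
%-scaled p D X d = trans (*-comm D ((X / D) % p)) (trans (m%n*o≡m*o%[n*o] (X / D) p D) (cong (_% (p * D)) (m/n*n≡m d)))

%-scale-cong : ∀ p D .{{_ : NonZero p}} .{{_ : NonZero D}} .{{_ : NonZero (p * D)}} c e s →
               c % p ≡ (s * e) % p → (D * c) % (p * D) ≡ (s * (D * e)) % (p * D)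
%-scale-cong p D c e s h = begin
    (D * c) % (p * D)       ≡⟨ cong (_% (p * D)) (*-comm D c) ⟩
    (c * D) % (p * D)       ≡⟨ sym (m%n*o≡m*o%[n*o] c p D) ⟩
    c % p * D               ≡⟨ cong (_* D) h ⟩
    (s * e) % p * D         ≡⟨ m%n*o≡m*o%[n*o] (s * e) p D ⟩
    (s * e * D) % (p * D)   ≡⟨ cong (_% (p * D)) (rearrange s e D) ⟩
    (s * (D * e)) % (p * D) ∎
  where
  open ≡-Reasoning
  rearrange : ∀ x y z → x * y * z ≡ x * (z * y)
  rearrange = solve 3 (λ x y z → x :* y :* z := x :* (z :* y)) refl

-- Arithmetic modulo a prime p, on natural-number representatives.
module Residues (p : ℕ) (pp : Prime p) where
  instance
    p≢0 : NonZero p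
    p≢0 = prime⇒nonZero pp

  1<p : 1 < p
  1<p = nonTrivial⇒n>1 p {{prime⇒nonTrivial pp}}

  0%p : 0 % p ≡ 0
  0%p = m<n⇒m%n≡m (<-trans (s≤s z≤n) 1<p)

  infix 4 _≈_
  _≈_ : ℕ → ℕ → Set
  a ≈ b = a % p ≡ b % p

  ≡⇒≈ : ∀ {a b} → a ≡ b → a ≈ b
  ≡⇒≈ = cong (_% p)

  ≈-*ˡ : ∀ c {a b} → a ≈ b → c * a ≈ c * b
  ≈-*ˡ c = %-*-congˡ c p

  ≈-*ʳ : ∀ c {a b} → a ≈ b → a * c ≈ b * c
  ≈-*ʳ c {a} {b} e rewrite *-comm a c | *-comm b c = ≈-*ˡ c e

  ≈-reduce : ∀ a → a % p ≈ a
  ≈-reduce a = m%n%n≡m%n a p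

  ∣⇒≈0 : ∀ {a} → p ∣ a → a ≈ 0
  ∣⇒≈0 {a} d = trans (n∣m⇒m%n≡0 a p d) (sym 0%p)

  ≈0⇒∣ : ∀ {a} → a ≈ 0 → p ∣ a
  ≈0⇒∣ {a} e = m%n≡0⇒n∣m a p (trans e 0%p)

  Unit : ℕ → Set
  Unit a = ¬ (p ∣ a)

  unit-1 : Unit 1
  unit-1 d = <⇒≱ 1<p (∣⇒≤ d)

  unit-* : ∀ {a b} → Unit a → Unit b → Unit (a * b)
  unit-* {a} {b} ua ub d with euclidsLemma a b pp d
  ... | inj₁ p∣a = ua p∣a
  ... | inj₂ p∣b = ub p∣b

  unit-coprime : ∀ {a} → Unit a → Coprime a p
  unit-coprime ua {i} (i∣a , i∣p) with prime⇒irreducible pp i∣p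
  ... | inj₁ i≡1 = i≡1
  ... | inj₂ refl = ⊥-elim (ua i∣a)

  -- Every unit has an inverse modulo p (Bézout's identity for a and p).
  inverse : ∀ a → Unit a → Σ ℕ λ b → a * b ≈ 1
  inverse a ua with coprime-Bézout (unit-coprime ua)
  ... | Bézout.+- x y eq = x , (begin
        (a * x) % p     ≡⟨ cong (_% p) (trans (*-comm a x) (sym eq)) ⟩
        (1 + y * p) % p ≡⟨ [m+kn]%n≡m%n 1 y p ⟩
        1 % p           ∎)
    where open ≡-Reasoning
  ... | Bézout.-+ x y eq = x * q , (begin
        (a * (x * q)) % p         ≡⟨ sym ([m+kn]%n≡m%n (a * (x * q)) 1 p) ⟩
        (a * (x * q) + 1 * p) % p ≡⟨ cong (_% p) key ⟩
        (1 + (y * q) * p) % p     ≡⟨ [m+kn]%n≡m%n 1 (y * q) p ⟩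
        1 % p                     ∎)
    where
    open ≡-Reasoning
    -- From 1 + x·a = y·p, multiplying by q = p − 1 gives a·(x·q) ≡ 1.
    q = p ∸ 1
    p≡1+q : p ≡ suc q
    p≡1+q = sym (m+[n∸m]≡n (<⇒≤ 1<p))
    key : a * (x * q) + 1 * p ≡ 1 + (y * q) * p
    key = begin
      a * (x * q) + 1 * p     ≡⟨ cong (λ z → a * (x * q) + 1 * z) p≡1+q ⟩
      a * (x * q) + 1 * suc q ≡⟨ solve 3 (λ a x q → a :* (x :* q) :+ con 1 :* (con 1 :+ q)
                                                  := con 1 :+ (con 1 :+ x :* a) :* q) refl a x q ⟩
      1 + (1 + x * a) * q     ≡⟨ cong (λ z → 1 + z * q) eq ⟩
      1 + (y * p) * q         ≡⟨ cong (1 +_) (solve 3 (λ y p q → (y :* p) :* q := (y :* q) :* p) refl y p q) ⟩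
      1 + (y * q) * p         ∎

  inv : ∀ a → Unit a → ℕ
  inv a ua = proj₁ (inverse a ua)

  inv-correct : ∀ a (ua : Unit a) → a * inv a ua ≈ 1
  inv-correct a ua = proj₂ (inverse a ua)

  inv-unique : ∀ a (ua : Unit a) b → b * a ≈ 1 → b ≈ inv a ua
  inv-unique a ua b e = begin
      b % p             ≡⟨ ≡⇒≈ (sym (*-identityʳ b)) ⟩
      (b * 1) % p       ≡⟨ ≈-*ˡ b (sym (inv-correct a ua)) ⟩
      (b * (a * i)) % p ≡⟨ ≡⇒≈ (sym (*-assoc b a i)) ⟩
      ((b * a) * i) % p ≡⟨ ≈-*ʳ i e ⟩
      (1 * i) % p       ≡⟨ ≡⇒≈ (*-identityˡ i) ⟩
      i % p             ∎
    where open ≡-Reasoning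
          i = inv a ua

  unitFactor : ∀ k → k ≢ 0 → Σ ℕ λ a → Σ ℕ λ k' → Unit k' × k ≡ p ^ a * k'
  unitFactor k = bounded k k ≤-refl
    where
    bounded : ∀ fuel k → k ≤ fuel → k ≢ 0 → Σ ℕ λ a → Σ ℕ λ k' → Unit k' × k ≡ p ^ a * k'
    bounded fuel k k≤fuel k≢0 with p ∣? k
    ... | no uk = 0 , k , uk , sym (+-identityʳ k)
    bounded zero k k≤0 k≢0 | yes _ = ⊥-elim (k≢0 (n≤0⇒n≡0 k≤0))
    bounded (suc fuel) k k≤fuel k≢0 | yes (divides q k≡qp)
      with bounded fuel q (≤-pred (≤-trans q<k k≤fuel)) q≢0
      where
      q≢0 : q ≢ 0
      q≢0 refl = k≢0 k≡qp
      q<k : q < k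
      q<k = subst (q <_) (sym k≡qp) (m<m*n q p {{≢-nonZero q≢0}} 1<p)
    ... | a , k' , uk' , q≡ = suc a , k' , uk' , (begin
        k               ≡⟨ k≡qp ⟩
        q * p           ≡⟨ cong (_* p) q≡ ⟩
        p ^ a * k' * p  ≡⟨ solve 3 (λ x y z → x :* y :* z := z :* x :* y) refl (p ^ a) k' p ⟩
        p * p ^ a * k'  ∎)
      where open ≡-Reasoning

  unit-cancel-∣ : ∀ {k z} n → Unit k → p ^ n ∣ k * z → p ^ n ∣ z
  unit-cancel-∣ {z = z} zero uk _ = 1∣ z
  unit-cancel-∣ {k} {z} (suc n) uk d with euclidsLemma k z pp (∣-trans (m∣m*n (p ^ n)) d)
  ... | inj₁ p∣k = ⊥-elim (uk p∣k)
  ... | inj₂ (divides z' refl) =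
    subst (p * p ^ n ∣_) (*-comm p z') (*-monoʳ-∣ p (unit-cancel-∣ n uk (*-cancelˡ-∣ p (subst (p * p ^ n ∣_) e d))))
    where e : k * (z' * p) ≡ p * (k * z')
          e = solve 3 (λ a b c → a :* (b :* c) := c :* (a :* b)) refl k z' p

  quotient-cong : ∀ D .{{_ : NonZero D}} .{{_ : NonZero (p * D)}} X Y c → D ∣ X → D ∣ Y →
                  X % (p * D) ≡ (c * Y) % (p * D) → X / D ≈ c * (Y / D)
  quotient-cong D X Y c D∣X D∣Y e = *-cancelˡ-≡ _ _ D (begin
      D * ((X / D) % p)       ≡⟨ %-scaled p D X D∣X ⟩
      X % (p * D)             ≡⟨ e ⟩
      (c * Y) % (p * D)       ≡⟨ sym (%-scaled p D (c * Y) (∣n⇒∣m*n c D∣Y)) ⟩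
      D * ((c * Y / D) % p)   ≡⟨ cong (λ z → D * (z % p)) cY/D ⟩
      D * ((c * (Y / D)) % p) ∎)
    where
    open ≡-Reasoning
    cY/D : c * Y / D ≡ c * (Y / D)
    cY/D = trans (/-congˡ (trans (cong (c *_) (sym (m/n*n≡m D∣Y))) (sym (*-assoc c (Y / D) D)))) (m*n/n≡m (c * (Y / D)) D)

  toℕ-mod : ∀ a → toℕ (a mod p) ≡ a % p
  toℕ-mod a = toℕ-fromℕ< (m%n<n a p)

  mod-cong : ∀ {a b} → a ≈ b → a mod p ≡ b mod p
  mod-cong {a} {b} e = toℕ-injective (trans (toℕ-mod a) (trans e (sym (toℕ-mod b))))

  toℕ-mod-id : ∀ (x : Fin p) → toℕ x mod p ≡ x
  toℕ-mod-id x = toℕ-injective (trans (toℕ-mod (toℕ x)) (m<n⇒m%n≡m (toℕ<n x)))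

-- The projective space P^{r-1}(𝔽_p): points, normalisation of vectors, and
-- the count (p^r − 1)/(p − 1) of points.
module ProjectiveSpace (p : ℕ) (pp : Prime p) where
  open Residues p pp

  -- Normalised representatives: nonzero vectors over 𝔽_p whose first
  -- nonzero coordinate is 1.
  data Point : ℕ → Set where
    zero∷_ : ∀ {r} → Point r → Point (suc r)
    one∷_  : ∀ {r} → Vec (Fin p) r → Point (suc r)

  coords : ∀ {r} → Point r → Vec ℕ r
  coords (zero∷ P) = 0 ∷ coords P
  coords (one∷ v) = 1 ∷ map toℕ v

  coords-< : ∀ {r} (P : Point r) i → lookup (coords P) i < p
  coords-< (zero∷ P) Fin.zero = <-trans (s≤s z≤n) 1<p
  coords-< (zero∷ P) (Fin.suc i) = coords-< P i
  coords-< (one∷ v) Fin.zero = 1<p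
  coords-< (one∷ v) (Fin.suc i) rewrite lookup-map i toℕ v = toℕ<n (lookup v i)

  coords-nonzero : ∀ {r} (P : Point r) → ¬ (∀ i → p ∣ lookup (coords P) i)
  coords-nonzero (zero∷ P) h = coords-nonzero P (λ i → h (Fin.suc i))
  coords-nonzero (one∷ v) h = unit-1 (h Fin.zero)

  normalize : ∀ {r} → Vec ℕ r → Maybe (Point r)
  normalize [] = nothing
  normalize (x ∷ c) with p ∣? x
  ... | yes _ = Maybe.map zero∷_ (normalize c)
  ... | no ux = just (one∷ map (λ y → (inv x ux * y) mod p) c)

  normalize-scale : ∀ {r} s → Unit s → (c c' : Vec ℕ r) →
                    (∀ i → lookup c i ≈ s * lookup c' i) → normalize c ≡ normalize c'
  normalize-scale s us [] [] h = refl
  normalize-scale s us (x ∷ c) (x' ∷ c') h with p ∣? x | p ∣? x'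
  ... | yes _ | yes _ = cong (Maybe.map zero∷_) (normalize-scale s us c c' (λ i → h (Fin.suc i)))
  ... | yes p∣x | no ux' = ⊥-elim (unit-* us ux' (%-∣ p (h Fin.zero) p∣x))
  ... | no ux | yes p∣x' = ⊥-elim (ux (%-∣ p (sym (h Fin.zero)) (∣n⇒∣m*n s p∣x')))
  ... | no ux | no ux' = cong (λ v → just (one∷ v)) (vecExt _ _ λ i →
        trans (lookup-map i _ c) (trans (mod-cong (tail i)) (sym (lookup-map i _ c'))))
    where
    open ≡-Reasoning
    ix = inv x ux
    ix' = inv x' ux'
    factors : ix * s ≈ ix'
    factors = inv-unique x' ux' (ix * s) (begin
       ((ix * s) * x') % p ≡⟨ ≡⇒≈ (*-assoc ix s x') ⟩
       (ix * (s * x')) % p ≡⟨ ≈-*ˡ ix (sym (h Fin.zero)) ⟩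
       (ix * x) % p        ≡⟨ ≡⇒≈ (*-comm ix x) ⟩
       (x * ix) % p        ≡⟨ inv-correct x ux ⟩
       1 % p               ∎)
    tail : ∀ i → ix * lookup c i ≈ ix' * lookup c' i
    tail i = begin
       (ix * lookup c i) % p         ≡⟨ ≈-*ˡ ix (h (Fin.suc i)) ⟩
       (ix * (s * lookup c' i)) % p  ≡⟨ ≡⇒≈ (sym (*-assoc ix s _)) ⟩
       ((ix * s) * lookup c' i) % p  ≡⟨ ≈-*ʳ (lookup c' i) factors ⟩
       (ix' * lookup c' i) % p       ∎

  normalize-defined : ∀ {r} (c : Vec ℕ r) → ¬ (∀ i → p ∣ lookup c i) → Σ (Point r) λ P → normalize c ≡ just P
  normalize-defined [] c≢0 = ⊥-elim (c≢0 (λ ()))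
  normalize-defined (x ∷ c) c≢0 with p ∣? x
  ... | no _ = _ , refl
  ... | yes p∣x with normalize-defined c (λ h → c≢0 (λ { Fin.zero → p∣x ; (Fin.suc i) → h i }))
  ... | P , eq = zero∷ P , cong (Maybe.map zero∷_) eq

  normalize-coords : ∀ {r} (P : Point r) → normalize (coords P) ≡ just P
  normalize-coords (zero∷ P) with p ∣? 0
  ... | yes _ = cong (Maybe.map zero∷_) (normalize-coords P)
  ... | no ¬p∣0 = ⊥-elim (¬p∣0 (p ∣0))
  normalize-coords (one∷ v) with p ∣? 1
  ... | yes p∣1 = ⊥-elim (unit-1 p∣1)
  ... | no u1 = cong (λ w → just (one∷ w)) (vecExt _ _ λ i →
        trans (lookup-map i _ (map toℕ v)) (trans (cong (λ z → (inv 1 u1 * z) mod p) (lookup-map i toℕ v))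
          (trans (mod-cong (entry (lookup v i))) (toℕ-mod-id (lookup v i)))))
    where
    -- 1⁻¹ ≡ 1, so normalisation leaves the tail unchanged.
    entry : ∀ y → inv 1 u1 * toℕ y ≈ toℕ y
    entry y = trans (≈-*ʳ (toℕ y) (sym (inv-unique 1 u1 1 refl))) (≡⇒≈ (*-identityˡ (toℕ y)))

  normalize-represents : ∀ {r} (c : Vec ℕ r) P → normalize c ≡ just P →
                         Σ ℕ λ s → Unit s × (∀ i → lookup c i ≈ s * lookup (coords P) i)
  normalize-represents [] P ()
  normalize-represents (x ∷ c) P e with p ∣? x
  normalize-represents (x ∷ c) P e | yes p∣x with normalize c in eq
  normalize-represents (x ∷ c) P () | yes p∣x | nothing
  normalize-represents (x ∷ c) .(zero∷ P') refl | yes p∣x | just P' with normalize-represents c P' eq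
  ... | s , us , h = s , us , λ { Fin.zero → trans (∣⇒≈0 p∣x) (≡⇒≈ (sym (*-zeroʳ s))) ; (Fin.suc i) → h i }
  normalize-represents (x ∷ c) .(one∷ map (λ y → (inv x ux * y) mod p) c) refl | no ux =
    x , ux , λ { Fin.zero → ≡⇒≈ (sym (*-identityʳ x)) ; (Fin.suc i) → tail i }
    where
    open ≡-Reasoning
    ix = inv x ux
    tail : ∀ i → lookup c i ≈ x * lookup (map toℕ (map (λ y → (ix * y) mod p) c)) i
    tail i rewrite lookup-map i toℕ (map (λ y → (ix * y) mod p) c)
                 | lookup-map i (λ y → (ix * y) mod p) c
                 | toℕ-mod (ix * lookup c i) = sym (begin
       (x * ((ix * y) % p)) % p ≡⟨ ≈-*ˡ x (≈-reduce (ix * y)) ⟩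
       (x * (ix * y)) % p       ≡⟨ ≡⇒≈ (sym (*-assoc x ix y)) ⟩
       ((x * ix) * y) % p       ≡⟨ ≈-*ʳ y (inv-correct x ux) ⟩
       (1 * y) % p              ≡⟨ ≡⇒≈ (*-identityˡ y) ⟩
       y % p                    ∎)
      where y = lookup c i

  anotherPoint : ∀ {r} → 2 ≤ r → (P : Point r) → Σ (Point r) λ Q → Q ≢ P
  anotherPoint {suc (suc r)} _ (zero∷ P) = one∷ replicate (suc r) (0 mod p) , λ ()
  anotherPoint {suc (suc r)} _ (one∷ v) = zero∷ (one∷ replicate r (0 mod p)) , λ ()
  anotherPoint {suc zero} (s≤s ()) _

  count : ℕ → ℕ
  count zero = 0
  count (suc r) = count r + p ^ r

  vectors↔ : ∀ r → Vec (Fin p) r ↔ Fin (p ^ r)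
  vectors↔ zero = mk↔ₛ′ (λ _ → Fin.zero) (λ _ → []) (λ { Fin.zero → refl ; (Fin.suc ()) }) (λ { [] → refl })
  vectors↔ (suc r) = ↔-trans uncons (↔-trans (↔-refl ×-↔ vectors↔ r) (↔-sym *↔×))
    where
    uncons : Vec (Fin p) (suc r) ↔ (Fin p × Vec (Fin p) r)
    uncons = mk↔ₛ′ (λ { (x ∷ v) → x , v }) (λ (x , v) → x ∷ v) (λ _ → refl) (λ { (x ∷ v) → refl })

  -- A point with 1 + r coordinates either has first coordinate 0 followed by
  -- a point with r coordinates, or first coordinate 1 followed by any vector.
  points↔ : ∀ r → Point r ↔ Fin (count r)
  points↔ zero = mk↔ₛ′ (λ ()) (λ ()) (λ ()) (λ ())
  points↔ (suc r) = ↔-trans split (↔-trans (points↔ r ⊎-↔ vectors↔ r) (↔-sym +↔⊎))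
    where
    split : Point (suc r) ↔ (Point r ⊎ Vec (Fin p) r)
    split = mk↔ₛ′ (λ { (zero∷ P) → inj₁ P ; (one∷ v) → inj₂ v })
                  (λ { (inj₁ P) → zero∷ P ; (inj₂ v) → one∷ v })
                  (λ { (inj₁ P) → refl ; (inj₂ v) → refl }) (λ { (zero∷ P) → refl ; (one∷ v) → refl })

  count-closed : ∀ r → count r * (p ∸ 1) + 1 ≡ p ^ r
  count-closed zero = refl
  count-closed (suc r) = begin
      (count r + p ^ r) * (p ∸ 1) + 1         ≡⟨ distrib (count r) (p ^ r) (p ∸ 1) ⟩
      (count r * (p ∸ 1) + 1) + p ^ r * (p ∸ 1) ≡⟨ cong (_+ p ^ r * (p ∸ 1)) (count-closed r) ⟩
      p ^ r + p ^ r * (p ∸ 1)                 ≡⟨ cong (p ^ r +_) (*-comm (p ^ r) (p ∸ 1)) ⟩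
      (1 + (p ∸ 1)) * p ^ r                   ≡⟨ cong (_* p ^ r) (m+[n∸m]≡n (<⇒≤ 1<p)) ⟩
      p * p ^ r                               ∎
    where
    open ≡-Reasoning
    distrib : ∀ a b c → (a + b) * c + 1 ≡ (a * c + 1) + b * c
    distrib = solve 3 (λ a b c → (a :+ b) :* c :+ con 1 := (a :* c :+ con 1) :+ b :* c) refl

  count-quotient : ∀ r .{{_ : NonZero (p ∸ 1)}} → (p ^ r ∸ 1) / (p ∸ 1) ≡ count r
  count-quotient r = begin
      (p ^ r ∸ 1) / (p ∸ 1)                       ≡⟨ /-congˡ (cong (_∸ 1) (sym (count-closed r))) ⟩
      (count r * (p ∸ 1) + 1 ∸ 1) / (p ∸ 1)       ≡⟨ /-congˡ (m+n∸n≡m (count r * (p ∸ 1)) 1) ⟩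
      count r * (p ∸ 1) / (p ∸ 1)                 ≡⟨ m*n/n≡m (count r) (p ∸ 1) ⟩
      count r                                     ∎
    where open ≡-Reasoning

-- Orders, socle and labels in G = ℤ_{p^{t₁}} × ⋯ × ℤ_{p^{tᵣ}} (all tᵢ ≥ 1).
module Labels (p : ℕ) (pp : Prime p) {r : ℕ} (t : Vec ℕ r) (t≥1 : ∀ i → 1 ≤ lookup t i) where
  open Residues p pp
  open ProjectiveSpace p pp

  -- Tᵢ = p^{tᵢ} is the order of the i-th factor and Dᵢ = p^{tᵢ−1} = Tᵢ / p;
  -- the socle of the i-th factor is Dᵢ·ℤ_{p^{tᵢ}} ≅ 𝔽_p.
  T : Fin r → ℕ
  T i = p ^ lookup t i

  D : Fin r → ℕ
  D i = p ^ (lookup t i ∸ 1)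

  instance
    T≢0 : ∀ {i} → NonZero (T i)
    T≢0 {i} = m^n≢0 p (lookup t i)

    D≢0 : ∀ {i} → NonZero (D i)
    D≢0 {i} = m^n≢0 p (lookup t i ∸ 1)

    pD≢0 : ∀ {i} → NonZero (p * D i)
    pD≢0 {i} = m*n≢0 p (D i)

  -- This is where tᵢ ≥ 1 is needed.
  T≡pD : ∀ i → T i ≡ p * D i
  T≡pD i = lemma (lookup t i) (t≥1 i)
    where lemma : ∀ n → 1 ≤ n → p ^ n ≡ p * p ^ (n ∸ 1)
          lemma (suc n) _ = refl

  0G : Vec ℕ r
  0G = replicate r 0

  -- p^j·u = 0 in G.  (A record, so that u and j can be inferred from it.)
  record Vanishes (u : Vec ℕ r) (j : ℕ) : Set where
    constructor vanishes
    field entrywise : ∀ i → T i ∣ p ^ j * lookup u i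
  open Vanishes public

  vanishes? : ∀ u j → Dec (Vanishes u j)
  vanishes? u j with all? (λ i → T i ∣? (p ^ j * lookup u i))
  ... | yes h = yes (vanishes h)
  ... | no ¬h = no (λ h → ¬h (entrywise h))

  vanishes-+ : ∀ {u j} d → Vanishes u j → Vanishes u (d + j)
  vanishes-+ zero h = h
  vanishes-+ {u} {j} (suc d) h = vanishes λ i →
    subst (T i ∣_) (sym (*-assoc p (p ^ (d + j)) (lookup u i))) (∣n⇒∣m*n p (entrywise (vanishes-+ d h) i))

  vanishes-0G : ∀ j → Vanishes 0G j
  vanishes-0G j = vanishes λ i → subst (λ z → T i ∣ p ^ j * z) (sym (lookup-replicate i 0))
                                   (subst (T i ∣_) (sym (*-zeroʳ (p ^ j))) (T i ∣0))

  vanishes-exponent : ∀ u → Vanishes u (sum t)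
  vanishes-exponent u = vanishes λ i →
    ∣m⇒∣m*n (lookup u i) (subst (T i ∣_) (sym (split i)) (m∣m*n (p ^ (sum t ∸ lookup t i))))
    where split : ∀ i → p ^ sum t ≡ T i * p ^ (sum t ∸ lookup t i)
          split i = trans (cong (p ^_) (sym (m+[n∸m]≡n (lookup≤sum t i)))) (^-distribˡ-+-* p (lookup t i) _)

  nonzero⇒¬vanishes0 : ∀ {u} → InG p t u → u ≢ 0G → ¬ Vanishes u 0
  nonzero⇒¬vanishes0 {u} u∈G u≢0 h = u≢0 (vecExt u 0G λ i → trans (uᵢ≡0 i) (sym (lookup-replicate i 0)))
    where uᵢ≡0 : ∀ i → lookup u i ≡ 0
          uᵢ≡0 i = trans (sym (m<n⇒m%n≡m (u∈G i)))
                         (n∣m⇒m%n≡0 _ (T i) (subst (T i ∣_) (*-identityˡ (lookup u i)) (entrywise h i)))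

  ExactOrder : Vec ℕ r → ℕ → Set
  ExactOrder u j = ¬ Vanishes u j × Vanishes u (suc j)

  exactOrder-unique : ∀ {u j j'} → ExactOrder u j → ExactOrder u j' → j ≡ j'
  exactOrder-unique {u} {j} {j'} (¬vj , vj+1) (¬vj' , vj'+1) with <-cmp j j'
  ... | tri≈ _ j≡j' _ = j≡j'
  ... | tri< j<j' _ _ = ⊥-elim (¬vj' (subst (Vanishes u) (m∸n+n≡m j<j') (vanishes-+ (j' ∸ suc j) vj+1)))
  ... | tri> _ _ j>j' = ⊥-elim (¬vj (subst (Vanishes u) (m∸n+n≡m j>j') (vanishes-+ (j ∸ suc j') vj'+1)))

  exactOrder-exists : ∀ {u} → InG p t u → u ≢ 0G → Σ ℕ (ExactOrder u)
  exactOrder-exists {u} u∈G u≢0 =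
    firstSwitch (Vanishes u) (vanishes? u) (nonzero⇒¬vanishes0 u∈G u≢0) (sum t) (vanishes-exponent u)

  exactOrder⇒≢0 : ∀ {u j} → ExactOrder u j → u ≢ 0G
  exactOrder⇒≢0 {j = j} (¬vj , _) refl = ¬vj (vanishes-0G j)

  -- The 𝔽_p-coordinates of p^j·u in the socle (meaningful when p^(1+j)·u = 0).
  socle : Vec ℕ r → ℕ → Vec ℕ r
  socle u j = tabulate λ i → ((p ^ j * lookup u i) / D i) % p

  socle-entry : ∀ u j i → lookup (socle u j) i ≡ ((p ^ j * lookup u i) / D i) % p
  socle-entry u j i = lookup∘tabulate _ i

  embed : Vec ℕ r → Vec ℕ r
  embed c = tabulate λ i → D i * lookup c i

  embed-entry : ∀ c i → lookup (embed c) i ≡ D i * lookup c i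
  embed-entry c i = lookup∘tabulate _ i

  D∣ : ∀ {u j} → Vanishes u (suc j) → ∀ i → D i ∣ p ^ j * lookup u i
  D∣ {u} {j} h i = *-cancelˡ-∣ p (subst (_∣ p * (p ^ j * lookup u i)) (T≡pD i)
                     (subst (T i ∣_) (*-assoc p (p ^ j) (lookup u i)) (entrywise h i)))

  embed-socle : ∀ {u j} → Vanishes u (suc j) → ∀ i → lookup (embed (socle u j)) i ≡ (p ^ j * lookup u i) % T i
  embed-socle {u} {j} h i = begin
      lookup (embed (socle u j)) i ≡⟨ embed-entry (socle u j) i ⟩
      D i * lookup (socle u j) i   ≡⟨ cong (D i *_) (socle-entry u j i) ⟩
      D i * ((X / D i) % p)        ≡⟨ %-scaled p (D i) X (D∣ h i) ⟩
      X % (p * D i)                ≡⟨ %-congʳ (sym (T≡pD i)) ⟩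
      X % T i                      ∎
    where open ≡-Reasoning
          X = p ^ j * lookup u i

  socle-nonzero : ∀ {u j} → ExactOrder u j → ¬ (∀ i → p ∣ lookup (socle u j) i)
  socle-nonzero {u} {j} (¬vj , vj+1) h = ¬vj (vanishes λ i → T∣X i (≈0⇒∣ (p∣⇒≈0 i)))
    where
    X : Fin r → ℕ
    X i = p ^ j * lookup u i
    p∣⇒≈0 : ∀ i → X i / D i ≈ 0
    p∣⇒≈0 i = trans (sym (≈-reduce (X i / D i))) (∣⇒≈0 (subst (p ∣_) (socle-entry u j i) (h i)))
    T∣X : ∀ i → p ∣ X i / D i → T i ∣ X i
    T∣X i (divides q X/D≡qp) = subst (_∣ X i) (sym (T≡pD i)) (divides q (begin
        X i               ≡⟨ sym (m/n*n≡m (D∣ vj+1 i)) ⟩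
        (X i / D i) * D i ≡⟨ cong (_* D i) X/D≡qp ⟩
        (q * p) * D i     ≡⟨ *-assoc q p (D i) ⟩
        q * (p * D i)     ∎))
      where open ≡-Reasoning

  HasLabel : Vec ℕ r → Point r → Set
  HasLabel u P = Σ ℕ λ m → ExactOrder u m × normalize (socle u m) ≡ just P

  label-unique : ∀ {u P Q} → HasLabel u P → HasLabel u Q → P ≡ Q
  label-unique {u} (m , ord , eq) (m' , ord' , eq') =
    just-injective (trans (sym eq) (trans (cong (λ z → normalize (socle u z)) (exactOrder-unique ord ord')) eq'))

  label-exists : ∀ {u} → InG p t u → u ≢ 0G → Σ (Point r) (HasLabel u)
  label-exists {u} u∈G u≢0 with exactOrder-exists u∈G u≢0
  ... | m , ord with normalize-defined (socle u m) (socle-nonzero ord)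
  ... | P , eq = P , m , ord , eq

  -- Let u = k·w in G, where u has order p^(1+m), and write k = p^a·k'
  -- with k' a unit.  Then w has order p^(1+m+a) and the socle element
  -- p^m·u is k' times the socle element p^(m+a)·w.
  module PowerOf {u w k m} (u≡kw : ∀ i → lookup u i % T i ≡ (k * lookup w i) % T i)
                 (ord : ExactOrder u m) where
    k≢0 : k ≢ 0
    k≢0 refl = proj₁ ord (subst (Vanishes u) (+-identityʳ m) (vanishes-+ m (vanishes λ i →
      subst (T i ∣_) (sym (*-identityˡ (lookup u i))) (%-∣ (T i) (sym (u≡kw i)) (T i ∣0)))))

    factorization = unitFactor k k≢0
    a = proj₁ factorization
    k' = proj₁ (proj₂ factorization)
    k'-unit : Unit k'
    k'-unit = proj₁ (proj₂ (proj₂ factorization))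
    k≡ : k ≡ p ^ a * k'
    k≡ = proj₂ (proj₂ (proj₂ factorization))

    shifted : ∀ n i → (p ^ n * lookup u i) % T i ≡ (k' * (p ^ (n + a) * lookup w i)) % T i
    shifted n i = trans (%-*-congˡ (p ^ n) (T i) (u≡kw i)) (cong (_% T i) (begin
        p ^ n * (k * wᵢ)              ≡⟨ cong (λ z → p ^ n * (z * wᵢ)) k≡ ⟩
        p ^ n * ((p ^ a * k') * wᵢ)   ≡⟨ regroup (p ^ n) (p ^ a) k' wᵢ ⟩
        k' * ((p ^ n * p ^ a) * wᵢ)   ≡⟨ cong (λ z → k' * (z * wᵢ)) (sym (^-distribˡ-+-* p n a)) ⟩
        k' * (p ^ (n + a) * wᵢ)       ∎))
      where
      open ≡-Reasoning
      wᵢ = lookup w i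
      regroup : ∀ x y z v → x * ((y * z) * v) ≡ z * ((x * y) * v)
      regroup = solve 4 (λ x y z v → x :* ((y :* z) :* v) := z :* ((x :* y) :* v)) refl

    order : ExactOrder w (m + a)
    order = (λ vw → proj₁ ord (vanishes λ i → %-∣ (T i) (sym (shifted m i)) (∣n⇒∣m*n k' (entrywise vw i))))
          , vanishes λ i → unit-cancel-∣ (lookup t i) k'-unit (%-∣ (T i) (shifted (suc m) i) (entrywise (proj₂ ord) i))

    socle-scaled : ∀ i → lookup (socle u m) i ≈ k' * lookup (socle w (m + a)) i
    socle-scaled i rewrite socle-entry u m i | socle-entry w (m + a) i = begin
        X / D i % p % p          ≡⟨ ≈-reduce (X / D i) ⟩
        X / D i % p              ≡⟨ quotient-cong (D i) X Y k' (D∣ (proj₂ ord) i) (D∣ (proj₂ order) i) X≡k'Y ⟩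
        k' * (Y / D i) % p       ≡⟨ ≈-*ˡ k' (sym (≈-reduce (Y / D i))) ⟩
        k' * (Y / D i % p) % p   ∎
      where
      open ≡-Reasoning
      X = p ^ m * lookup u i
      Y = p ^ (m + a) * lookup w i
      X≡k'Y : X % (p * D i) ≡ (k' * Y) % (p * D i)
      X≡k'Y = trans (%-congʳ (sym (T≡pD i))) (trans (shifted m i) (%-congʳ (T≡pD i)))

  label-of-power : ∀ {u w P} → IsPowerOf p t u w → HasLabel u P → HasLabel w P
  label-of-power {u} {w} (k , u≡kw) (m , ord , eq) =
    m + a , order , trans (sym (normalize-scale k' k'-unit (socle u m) (socle w (m + a)) socle-scaled)) eq
    where open PowerOf {w = w} {k = k} (λ i → [mod]⇒% (T i) (u≡kw i)) ord

  pointElement : Point r → Vec ℕ r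
  pointElement P = embed (coords P)

  pointElement∈G : ∀ P → InG p t (pointElement P)
  pointElement∈G P i = subst (_< T i) (sym (embed-entry (coords P) i))
    (subst (D i * lookup (coords P) i <_) (trans (*-comm (D i) p) (sym (T≡pD i))) (*-monoʳ-< (D i) (coords-< P i)))

  pointElement-order : ∀ P → ExactOrder (pointElement P) 0
  pointElement-order P = nonzero , vanishes λ i → subst₂ _∣_ (sym (T≡pD i)) (sym (rearrange i)) (n∣m*n (cᵢ i))
    where
    cᵢ : Fin r → ℕ
    cᵢ i = lookup (coords P) i
    rearrange : ∀ i → p ^ 1 * lookup (pointElement P) i ≡ cᵢ i * (p * D i)
    rearrange i = trans (cong (p ^ 1 *_) (embed-entry (coords P) i))
                    (solve 3 (λ x y z → (x :* con 1) :* (y :* z) := z :* (x :* y)) refl p (D i) (cᵢ i))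
    nonzero : ¬ Vanishes (pointElement P) 0
    nonzero h = coords-nonzero P λ i → *-cancelˡ-∣ (D i)
      (subst₂ _∣_ (trans (T≡pD i) (*-comm p (D i))) (trans (*-identityˡ _) (embed-entry (coords P) i)) (entrywise h i))

  pointElement-label : ∀ P → HasLabel (pointElement P) P
  pointElement-label P = 0 , pointElement-order P ,
    trans (normalize-scale 1 unit-1 (socle (pointElement P) 0) (coords P) entry) (normalize-coords P)
    where
    entry : ∀ i → lookup (socle (pointElement P) 0) i ≈ 1 * lookup (coords P) i
    entry i rewrite socle-entry (pointElement P) 0 i | embed-entry (coords P) i =
      trans (cong (λ z → z % p % p) cancel-D) (trans (≈-reduce cᵢ) (cong (_% p) (sym (*-identityˡ cᵢ))))
      where
      cᵢ = lookup (coords P) i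
      cancel-D : (1 * (D i * cᵢ)) / D i ≡ cᵢ
      cancel-D = trans (/-congˡ (trans (*-identityˡ _) (*-comm (D i) cᵢ))) (m*n/n≡m cᵢ (D i))

  module SocleOf {u P} (lab : HasLabel u P) where
    m = proj₁ lab
    ord : ExactOrder u m
    ord = proj₁ (proj₂ lab)

    y : Vec ℕ r
    y = embed (socle u m)

    y∈G : InG p t y
    y∈G i = subst (_< T i) (sym (embed-socle (proj₂ ord) i)) (m%n<n _ (T i))

    y≢0 : y ≢ 0G
    y≢0 y≡0 = socle-nonzero ord λ i → subst (p ∣_) (sym (socleᵢ≡0 i)) (p ∣0)
      where socleᵢ≡0 : ∀ i → lookup (socle u m) i ≡ 0
            socleᵢ≡0 i = *-cancelˡ-≡ _ _ (D i) (trans (sym (embed-entry (socle u m) i))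
                           (trans (cong (λ z → lookup z i) y≡0) (trans (lookup-replicate i 0) (sym (*-zeroʳ (D i))))))

    y-power-of-u : IsPowerOf p t y u
    y-power-of-u = p ^ m , λ i → %⇒[mod] (T i)
      (trans (cong (_% T i) (embed-socle (proj₂ ord) i)) (m%n%n≡m%n _ (T i)))

    y-power-of-point : IsPowerOf p t y (pointElement P)
    y-power-of-point = s , λ i → %⇒[mod] (T i) (begin
        lookup y i % T i                              ≡⟨ cong (_% T i) (embed-entry (socle u m) i) ⟩
        (D i * lookup (socle u m) i) % T i            ≡⟨ %-congʳ (T≡pD i) ⟩
        (D i * lookup (socle u m) i) % (p * D i)      ≡⟨ %-scale-cong p (D i) _ _ s (socle≈ i) ⟩
        (s * (D i * lookup (coords P) i)) % (p * D i) ≡⟨ %-congʳ (sym (T≡pD i)) ⟩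
        (s * (D i * lookup (coords P) i)) % T i       ≡⟨ cong (λ z → (s * z) % T i) (sym (embed-entry (coords P) i)) ⟩
        (s * lookup (pointElement P) i) % T i         ∎)
      where
      open ≡-Reasoning
      represents = normalize-represents (socle u m) P (proj₂ (proj₂ lab))
      s = proj₁ represents
      socle≈ = proj₂ (proj₂ represents)

-- The connected components of G**ₑ(G) for r ≥ 2.
module Components (p : ℕ) (pp : Prime p) {r : ℕ} (t : Vec ℕ r) (t≥1 : ∀ i → 1 ≤ lookup t i) (r≥2 : 2 ≤ r) where
  open Residues p pp
  open ProjectiveSpace p pp
  open Labels p pp t t≥1

  -- Along an edge a — b of Gₑ(G), both ends are powers of a common w and
  -- so share the label of w.  (Both ends must be nonzero to have labels.)
  label-along-edge : ∀ {a b P} → Adj p t a b → InG p t b → b ≢ 0G → HasLabel a P → HasLabel b P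
  label-along-edge {a} {b} (_ , w , _ , a-power , b-power) b∈G b≢0 labelₐ with label-exists b∈G b≢0
  ... | Q , labelᵦ = subst (HasLabel b)
          (label-unique (label-of-power {b} {w} b-power labelᵦ) (label-of-power {a} {w} a-power labelₐ)) labelᵦ

  power-refl : ∀ v → IsPowerOf p t v v
  power-refl v = 1 , λ i → 0 , 0 , cong (_+ 0) (sym (*-identityˡ (lookup v i)))

  -- 0 is a power of everything, hence dominating.
  0G-dominating : Dominating p t 0G
  0G-dominating v v∈G v≢0 =
    (λ 0≡v → v≢0 (sym 0≡v)) , v , v∈G , (0 , λ i → 0 , 0 , cong (_+ 0) (lookup-replicate i 0)) , power-refl v

  vertex⇒≢0 : ∀ {u} → Vertex** p t u → u ≢ 0G
  vertex⇒≢0 (_ , ¬dom) refl = ¬dom 0G-dominating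

  -- A nonzero u is not adjacent to pointElement Q for a label Q different
  -- from that of u, which exists because r ≥ 2.
  nonzero⇒¬dominating : ∀ {u} → InG p t u → u ≢ 0G → ¬ Dominating p t u
  nonzero⇒¬dominating {u} u∈G u≢0 dom with label-exists u∈G u≢0
  ... | P , labelᵤ with anotherPoint r≥2 P
  ... | Q , Q≢P with ≡-dec _≟_ (pointElement Q) u
  ... | yes e = Q≢P (label-unique (subst (λ z → HasLabel z Q) e (pointElement-label Q)) labelᵤ)
  ... | no e≢u = Q≢P (label-unique (pointElement-label Q)
          (label-along-edge (dom (pointElement Q) (pointElement∈G Q) e≢u) (pointElement∈G Q)
                            (exactOrder⇒≢0 (pointElement-order Q)) labelᵤ))

  nonzero⇒vertex : ∀ {u} → InG p t u → u ≢ 0G → Vertex** p t u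
  nonzero⇒vertex u∈G u≢0 = u∈G , nonzero⇒¬dominating u∈G u≢0

  label-along-path : ∀ {a b P} → Connected** p t a b → HasLabel a P → HasLabel b P
  label-along-path ε labelₐ = labelₐ
  label-along-path ((_ , vertexᵦ , adj) ◅ path) labelₐ =
    label-along-path path (label-along-edge adj (proj₁ vertexᵦ) (vertex⇒≢0 vertexᵦ) labelₐ)

  edge-or-equal : ∀ {a b} → Vertex** p t a → Vertex** p t b →
                  (∃ λ w → InG p t w × IsPowerOf p t a w × IsPowerOf p t b w) → Connected** p t a b
  edge-or-equal {a} {b} vertexₐ vertexᵦ cyclic with ≡-dec _≟_ a b
  ... | yes refl = ε
  ... | no a≢b = (vertexₐ , vertexᵦ , a≢b , cyclic) ◅ ε

  -- Vertices with the same label P are connected via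
  -- u — p^m·u — pointElement P — p^m'·v — v.
  same-label⇒connected : ∀ {u v P} → Vertex** p t u → Vertex** p t v →
                         HasLabel u P → HasLabel v P → Connected** p t u v
  same-label⇒connected {u} {v} {P} vertexᵤ vertexᵥ labelᵤ labelᵥ =
    edge-or-equal vertexᵤ vertex-yᵤ (u , proj₁ vertexᵤ , power-refl u , Sᵤ.y-power-of-u) ◅◅
    (edge-or-equal vertex-yᵤ vertex-yᵥ
       (pointElement P , pointElement∈G P , Sᵤ.y-power-of-point , Sᵥ.y-power-of-point) ◅◅
    edge-or-equal vertex-yᵥ vertexᵥ (v , proj₁ vertexᵥ , Sᵥ.y-power-of-u , power-refl v))
    where
    module Sᵤ = SocleOf labelᵤ
    module Sᵥ = SocleOf labelᵥ
    vertex-yᵤ = nonzero⇒vertex Sᵤ.y∈G Sᵤ.y≢0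
    vertex-yᵥ = nonzero⇒vertex Sᵥ.y∈G Sᵥ.y≢0

  Vertex : Set
  Vertex = Σ (Vec ℕ r) (Vertex** p t)

  label : Vertex → Point r
  label (_ , vertexᵤ) = proj₁ (label-exists (proj₁ vertexᵤ) (vertex⇒≢0 vertexᵤ))

  label-correct : ∀ x → HasLabel (proj₁ x) (label x)
  label-correct (_ , vertexᵤ) = proj₂ (label-exists (proj₁ vertexᵤ) (vertex⇒≢0 vertexᵤ))

  pointVertex : Point r → Vertex
  pointVertex P = pointElement P , nonzero⇒vertex (pointElement∈G P) (exactOrder⇒≢0 (pointElement-order P))

  label-pointVertex : ∀ P → label (pointVertex P) ≡ P
  label-pointVertex P = label-unique (label-correct (pointVertex P)) (pointElement-label P)

  label-fibres : ∀ x y → (label x ≡ label y) ⇔ Connected** p t (proj₁ x) (proj₁ y)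
  label-fibres x y = mk⇔
    (λ same → same-label⇒connected (proj₂ x) (proj₂ y)
                (label-correct x) (subst (HasLabel (proj₁ y)) (sym same) (label-correct y)))
    (λ path → label-unique (label-along-path path (label-correct x)) (label-correct y))

  component-count : NumComponents** p t (count r)
  component-count = to ∘ label , surjective , fibres
    where
    open Inverse (points↔ r)
    surjective : Surjective _≡_ _≡_ (to ∘ label)
    surjective n = pointVertex (from n) , λ { refl → trans (cong to (label-pointVertex (from n))) (strictlyInverseˡ n) }
    to-injective : ∀ {P Q} → to P ≡ to Q → P ≡ Q
    to-injective {P} {Q} e = trans (sym (strictlyInverseʳ P)) (trans (cong from e) (strictlyInverseʳ Q))
    fibres : ∀ x y → (to (label x) ≡ to (label y)) ⇔ Connected** p t (proj₁ x) (proj₁ y)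
    fibres x y = mk⇔ (λ e → Equivalence.to (label-fibres x y) (to-injective e))
                     (λ c → cong to (Equivalence.from (label-fibres x y) c))

-- Main theorem: for r ≥ 2 and all tᵢ ≥ 1, G**ₑ(G) has (p^r − 1)/(p − 1) connected components.
mainTheorem8 : ∀ (p r : ℕ) (t : Vec ℕ r) → (pp : Prime p) → 2 ≤ r →
    (∀ (i : Fin r) → 1 ≤ lookup t i) →
    (∀ (i j : Fin r) → i ≤ᶠ j → lookup t i ≤ lookup t j) →
    NumComponents** p t (_/_ (p ^ r ∸ 1) (p ∸ 1) {{prime⇒pred-nonZero pp}})
mainTheorem8 p r t pp r≥2 t≥1 _ =
  subst (NumComponents** p t) (sym (count-quotient r {{prime⇒pred-nonZero pp}})) (component-count p pp t t≥1 r≥2)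
  where
  open ProjectiveSpace p pp using (count-quotient)
  open Components using (component-count)
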